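{- (i) Let $w\in A^*$. A column $\gamma$ satisfies $w\cdot\gamma=\gamma$ if and only if $\mathrm{Supp}(w)\subseteq\gamma$. (ii) The support of a word $w$ is the smallest, for inclusion, column fixed by the action of $w$. (iii) The idempotents of $\mathrm{Styl}(A)$ are exactly the images under $\mu$ of the strictly decreasing words. (iv) $\mathrm{Styl}(A)$ has exactly $2^{|A|}$ idempotents.
   Context: $A$ is a finite totally ordered alphabet, $A^*$ the free monoid, and $\mathrm{Supp}(w)$ the set of letters occurring in $w$. A column is a subset of $A$, identified with the strictly decreasing word of its elements. For a column $\gamma$ and a letter $x$: if $x>y$ for all $y\in\gamma$, $x\cdot\gamma=\gamma\cup\{x\}$; otherwise with $y$ the smallest element of $\gamma$ with $y\geq x$, $x\cdot\gamma=(\gamma\setminus\{y\})\cup\{x\}$; this extends to a left action of $A^*$ on the set of columns by $(uv)\cdot\gamma=u\cdot(v\cdot\gamma)$. $\mathrm{Styl}(A)$ is the monoid of maps on columns induced by words under this action and $\mu:A^*\to\mathrm{Styl}(A)$ the canonical surjective homomorphism. -}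

module Defs where

open import Data.Nat using (ℕ; _≤ᵇ_; _^_)
open import Data.Bool using (Bool; true; false; _∧_)
open import Data.Fin using (Fin; toℕ; _>_)
open import Data.Fin.Subset using (Subset; ⊥; ⁅_⁆; _∪_; _-_; _⊆_)
open import Data.Vec using (lookup)
open import Data.List using (List; []; _∷_; _++_; filter; allFin; foldr)
open import Data.List.Relation.Unary.Linked using (Linked)
open import Data.Maybe using (Maybe; just; nothing)
open import Data.Product using (Σ; _×_)
open import Relation.Binary.PropositionalEquality using (_≡_)
open import Relation.Nullary using (Dec; yes; no)
open import Data.Bool using (T)
open import Relation.Nullary.Decidable using (T?)

Column : ℕ → Set
Column n = Subset n

Word : ℕ → Set
Word n = List (Fin n)

-- smallest element y of γ with y ≥ x, if any (allFin lists letters increasingly)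
smallestGeq : ∀ {n} → Fin n → Column n → Maybe (Fin n)
smallestGeq {n} x γ with filter (λ y → T? (lookup γ y ∧ (toℕ x ≤ᵇ toℕ y))) (allFin n)
... | []    = nothing
... | y ∷ _ = just y

actL : ∀ {n} → Fin n → Column n → Column n
actL x γ with smallestGeq x γ
... | nothing = γ ∪ ⁅ x ⁆
... | just y  = (γ - y) ∪ ⁅ x ⁆

act : ∀ {n} → Word n → Column n → Column n
act []      γ = γ
act (x ∷ w) γ = actL x (act w γ)

-- μ : A* → Styl(A); elements of Styl(A) are maps on columns,
-- compared extensionally.
μ : ∀ {n} → Word n → (Column n → Column n)
μ w = act w

_≐_ : ∀ {n} → (Column n → Column n) → (Column n → Column n) → Set
f ≐ g = ∀ γ → f γ ≡ g γ

Supp : ∀ {n} → Word n → Column n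
Supp = foldr (λ x s → ⁅ x ⁆ ∪ s) ⊥

StrictlyDecreasing : ∀ {n} → Word n → Set
StrictlyDecreasing = Linked _>_

-- μ w is an idempotent of Styl(A): μ w ∘ μ w = μ w  (note μ (w ++ w) = μ w ∘ μ w)
IsIdempotent : ∀ {n} → Word n → Set
IsIdempotent w = μ (w ++ w) ≐ μ w

-- Order columns by domination of prefix counts: p ≼ q iff |p ∩ [0,t)| ≤ |q ∩ [0,t)| for all t.
-- The letter x leaves the counts below x unchanged and turns the count at t > x into
-- max(count γ t, 1 + count γ x), so every μ w is inflationary and monotone for ≼.
-- Inflationarity gives (i): if w·γ = γ then every suffix of w already fixes γ, and x·γ
-- always contains x. By (i), μ w is idempotent iff Supp w ⊆ w·γ for every γ; two such
-- words with the same support absorb each other (μ v ∘ μ u = μ u and μ u ∘ μ v = μ v),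
-- and inflationary monotone maps absorbing each other coincide. So an idempotent is
-- determined by its support, and equals μ of the decreasing word of that support;
-- (iv) then follows from Column n ≃ Fin 2^n.

module Submission where

open import Data.Bool using (T; _∧_)
open import Data.Bool.Properties using (T-∧; T-≡)
open import Data.Empty using (⊥-elim)
open import Data.Fin using (Fin; zero; suc; toℕ; opposite; _>_)
open import Data.Fin.Properties using (toℕ-injective; toℕ<n; opposite-prop; opposite-involutive; 2↔Bool; _≟_)
open import Data.Fin.Subset using (Subset; inside; outside; ⊥; ⁅_⁆; _∪_; _-_; _∈_; _∉_; _⊆_)
open import Data.Fin.Subset.Properties
  using (x∈⁅x⁆; x∈⁅y⁆⇒x≡y; x∈p∪q⁺; x∈p∪q⁻; x∈p∧x≢y⇒x∈p-y; p─q⊆p; ⊆-refl; ⊆-antisym; ∉⊥; _∈?_)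
open import Data.List using ([]; _∷_; _++_; filter; tabulate; allFin)
open import Data.List.Membership.Propositional using () renaming (_∈_ to _∈ₗ_)
open import Data.List.Membership.Propositional.Properties using (∈-filter⁺; ∈-filter⁻; ∈-allFin; ∈-tabulate⁺)
import Data.List.Relation.Unary.All as All
open import Data.List.Relation.Unary.AllPairs using (AllPairs; []; _∷_)
import Data.List.Relation.Unary.AllPairs.Properties as AllPairs
open import Data.List.Relation.Unary.Any using (here; there)
open import Data.List.Relation.Unary.Linked.Properties using (AllPairs⇒Linked; Linked⇒AllPairs)
open import Data.Maybe using (Maybe; just; nothing)
open import Data.Nat using (ℕ; zero; suc; _+_; _⊔_; _≤_; _<_; _^_; _≤ᵇ_; z≤n; s≤s)
open import Data.Nat.Properties
  using ( +-commutativeSemigroup; +-comm; +-suc; +-identityʳ; +-cancelʳ-≡; suc-injective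
        ; ≤-refl; ≤-reflexive; ≤-trans; ≤-antisym; ≤-pred; n≤1+n; <⇒≤; <⇒≱; ≰⇒>; <-irrefl; <-trans
        ; n≮0; ≤-<-connex; ≤ᵇ⇒≤; ≤⇒≤ᵇ; ∸-monoʳ-<; m≤m⊔n; ⊔-mono-≤; m≤n⇒m⊔n≡n; m≥n⇒m⊔n≡m
        ; module ≤-Reasoning )
open import Algebra.Properties.CommutativeSemigroup +-commutativeSemigroup using (xy∙z≈xz∙y)
open import Data.Product using (Σ; _×_; _,_; proj₁; proj₂)
open import Data.Sum using (inj₁; inj₂)
open import Data.Vec using ([]; _∷_; here; there; lookup)
open import Data.Vec.Properties using ([]=⇒lookup; lookup⇒[]=)
open import Data.Vec.Recursive using (Fin[m^n]↔Fin[m]^n; lift↔)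
open import Data.Vec.Recursive.Properties using (↔Vec)
open import Function using (_∘_; case_of_)
open import Function.Bundles using (_⇔_; mk⇔; _↔_; Inverse; Injection; Equivalence)
open import Function.Properties.Inverse using (↔-trans; ↔⇒↣)
open import Relation.Binary.PropositionalEquality
  using (_≡_; refl; sym; trans; cong; subst; subst₂; module ≡-Reasoning)
open import Relation.Nullary using (Dec; yes; no)
open import Relation.Nullary.Decidable using (T?)

open import Defs

x∉p-x : ∀ {n} {p : Subset n} {x} → x ∉ p - x
x∉p-x {p = outside ∷ p} {zero}  ()
x∉p-x {p = inside  ∷ p} {zero}  ()
x∉p-x {p = _       ∷ p} {suc x} (there x∈p-x) = x∉p-x x∈p-x

x∈p⇒p-x∪⁅x⁆≡p : ∀ {n} {p : Subset n} {x} → x ∈ p → (p - x) ∪ ⁅ x ⁆ ≡ p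
x∈p⇒p-x∪⁅x⁆≡p {p = p} {x} x∈p = ⊆-antisym ⊆p p⊆
  where
  ⊆p : (p - x) ∪ ⁅ x ⁆ ⊆ p
  ⊆p z∈ with x∈p∪q⁻ (p - x) ⁅ x ⁆ z∈
  ... | inj₁ z∈p-x = p─q⊆p p ⁅ x ⁆ z∈p-x
  ... | inj₂ z∈⁅x⁆ rewrite x∈⁅y⁆⇒x≡y x z∈⁅x⁆ = x∈p
  p⊆ : p ⊆ (p - x) ∪ ⁅ x ⁆
  p⊆ {z} z∈p with z ≟ x
  ... | yes refl = x∈p∪q⁺ (inj₂ (x∈⁅x⁆ x))
  ... | no z≢x   = x∈p∪q⁺ (inj₁ (x∈p∧x≢y⇒x∈p-y z∈p z≢x))

count : ∀ {n} → Subset n → ℕ → ℕ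
count _             zero    = 0
count []            (suc t) = 0
count (outside ∷ p) (suc t) = count p t
count (inside  ∷ p) (suc t) = suc (count p t)

count-⊥ : ∀ {n} t → count (⊥ {n}) t ≡ 0
count-⊥         zero    = refl
count-⊥ {zero}  (suc t) = refl
count-⊥ {suc n} (suc t) = count-⊥ {n} t

count-∪ : ∀ {n} {p q : Subset n} → (∀ {z} → z ∈ p → z ∉ q) →
          ∀ t → count (p ∪ q) t ≡ count p t + count q t
count-∪                             _        zero    = refl
count-∪ {p = []}          {[]}          _        (suc t) = refl
count-∪ {p = outside ∷ p} {outside ∷ q} disjoint (suc t) =
  count-∪ (λ z∈p → disjoint (there z∈p) ∘ there) t
count-∪ {p = outside ∷ p} {inside  ∷ q} disjoint (suc t) =
  trans (cong suc (count-∪ (λ z∈p → disjoint (there z∈p) ∘ there) t)) (sym (+-suc _ _))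
count-∪ {p = inside  ∷ p} {outside ∷ q} disjoint (suc t) =
  cong suc (count-∪ (λ z∈p → disjoint (there z∈p) ∘ there) t)
count-∪ {p = inside  ∷ p} {inside  ∷ q} disjoint (suc t) = ⊥-elim (disjoint here here)

count-⁅x⁆-≤ : ∀ {n} (x : Fin n) {t} → t ≤ toℕ x → count ⁅ x ⁆ t ≡ 0
count-⁅x⁆-≤ x       {zero}  _         = refl
count-⁅x⁆-≤ (suc x) {suc t} (s≤s t≤x) = count-⁅x⁆-≤ x t≤x

count-⁅x⁆-> : ∀ {n} (x : Fin n) {t} → toℕ x < t → count ⁅ x ⁆ t ≡ 1
count-⁅x⁆-> zero    {suc t} _         = cong suc (count-⊥ t)
count-⁅x⁆-> (suc x) {suc t} (s≤s x<t) = count-⁅x⁆-> x x<t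

count-mono : ∀ {n} (p : Subset n) {a b} → a ≤ b → count p a ≤ count p b
count-mono p             {zero}  _         = z≤n
count-mono []            {suc a} (s≤s _)   = z≤n
count-mono (outside ∷ p) {suc a} (s≤s a≤b) = count-mono p a≤b
count-mono (inside  ∷ p) {suc a} (s≤s a≤b) = s≤s (count-mono p a≤b)

count-suc-∈ : ∀ {n} {p : Subset n} {y} → y ∈ p → count p (suc (toℕ y)) ≡ suc (count p (toℕ y))
count-suc-∈                   here        = refl
count-suc-∈ {p = outside ∷ p} (there y∈p) = count-suc-∈ y∈p
count-suc-∈ {p = inside  ∷ p} (there y∈p) = cong suc (count-suc-∈ y∈p)

count-gap : ∀ {n} {p : Subset n} {a b} → (∀ {z} → z ∈ p → a ≤ toℕ z → b ≤ toℕ z) →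
            a ≤ b → count p b ≡ count p a
count-gap {a = zero}          {zero}  _   _         = refl
count-gap {p = []}          {zero}  {suc b} _   _         = refl
count-gap {p = outside ∷ p} {zero}  {suc b} gap _         =
  count-gap (λ z∈p _ → ≤-pred (gap (there z∈p) z≤n)) z≤n
count-gap {p = inside  ∷ p} {zero}  {suc b} gap _         = ⊥-elim (n≮0 (gap here z≤n))
count-gap {p = []}          {suc a} {suc b} _   _         = refl
count-gap {p = outside ∷ p} {suc a} {suc b} gap (s≤s a≤b) =
  count-gap (λ z∈p a≤z → ≤-pred (gap (there z∈p) (s≤s a≤z))) a≤b
count-gap {p = inside  ∷ p} {suc a} {suc b} gap (s≤s a≤b) =
  cong suc (count-gap (λ z∈p a≤z → ≤-pred (gap (there z∈p) (s≤s a≤z))) a≤b)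

count-injective : ∀ {n} {p q : Subset n} → (∀ t → count p t ≡ count q t) → p ≡ q
count-injective {p = []}          {[]}          _  = refl
count-injective {p = outside ∷ p} {outside ∷ q} eq = cong (outside ∷_) (count-injective (eq ∘ suc))
count-injective {p = inside  ∷ p} {inside  ∷ q} eq =
  cong (inside ∷_) (count-injective (suc-injective ∘ eq ∘ suc))
count-injective {p = outside ∷ p} {inside  ∷ q} eq = case eq 1 of λ ()
count-injective {p = inside  ∷ p} {outside ∷ q} eq = case eq 1 of λ ()

_≼_ : ∀ {n} → Subset n → Subset n → Set
p ≼ q = ∀ t → count p t ≤ count q t

≼-antisym : ∀ {n} {p q : Subset n} → p ≼ q → q ≼ p → p ≡ q
≼-antisym p≼q q≼p = count-injective λ t → ≤-antisym (p≼q t) (q≼p t)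

count-exchange : ∀ {n} {p : Subset n} {x y} → y ∈ p → x ∉ p - y →
                 ∀ t → count ((p - y) ∪ ⁅ x ⁆) t + count ⁅ y ⁆ t ≡ count p t + count ⁅ x ⁆ t
count-exchange {p = p} {x} {y} y∈p x∉p-y t = begin
  count ((p - y) ∪ ⁅ x ⁆) t + count ⁅ y ⁆ t       ≡⟨ cong (_+ count ⁅ y ⁆ t) (count-∪ (disjoint x∉p-y) t) ⟩
  count (p - y) t + count ⁅ x ⁆ t + count ⁅ y ⁆ t ≡⟨ xy∙z≈xz∙y (count (p - y) t) _ _ ⟩
  count (p - y) t + count ⁅ y ⁆ t + count ⁅ x ⁆ t ≡⟨ cong (_+ count ⁅ x ⁆ t) (count-∪ (disjoint x∉p-x) t) ⟨
  count ((p - y) ∪ ⁅ y ⁆) t + count ⁅ x ⁆ t       ≡⟨ cong (λ q → count q t + count ⁅ x ⁆ t) (x∈p⇒p-x∪⁅x⁆≡p y∈p) ⟩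
  count p t + count ⁅ x ⁆ t                       ∎
  where
  open ≡-Reasoning
  disjoint : ∀ {w} → w ∉ p - y → ∀ {z} → z ∈ p - y → z ∉ ⁅ w ⁆
  disjoint w∉ z∈ z∈⁅w⁆ rewrite x∈⁅y⁆⇒x≡y _ z∈⁅w⁆ = w∉ z∈

data SmallestGeq {n} (x : Fin n) (γ : Column n) : Maybe (Fin n) → Set where
  none  : (∀ {z} → z ∈ γ → toℕ z < toℕ x) → SmallestGeq x γ nothing
  least : ∀ {y} → y ∈ γ → toℕ x ≤ toℕ y → (∀ {z} → z ∈ γ → toℕ x ≤ toℕ z → toℕ y ≤ toℕ z) →
          SmallestGeq x γ (just y)

Geq : ∀ {n} → Fin n → Column n → Fin n → Set
Geq x γ y = T (lookup γ y ∧ (toℕ x ≤ᵇ toℕ y))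

-- Exactly the predicate filtered in smallestGeq, so that smallestGeq-spec can abstract over that filter.
geq? : ∀ {n} (x : Fin n) (γ : Column n) (y : Fin n) → Dec (Geq x γ y)
geq? x γ y = T? (lookup γ y ∧ (toℕ x ≤ᵇ toℕ y))

Geq⇔ : ∀ {n} {x : Fin n} {γ : Column n} {y} → Geq x γ y ⇔ (y ∈ γ × toℕ x ≤ toℕ y)
Geq⇔ {x = x} {γ} {y} = mk⇔
  (λ h → let (γy , x≤y) = Equivalence.to T-∧ h
         in lookup⇒[]= y γ (Equivalence.to T-≡ γy) , ≤ᵇ⇒≤ (toℕ x) (toℕ y) x≤y)
  (λ (y∈γ , x≤y) → Equivalence.from T-∧ (Equivalence.from T-≡ ([]=⇒lookup y∈γ) , ≤⇒≤ᵇ x≤y))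

allFin-sorted : ∀ n → AllPairs (λ a b → toℕ a ≤ toℕ b) (allFin n)
allFin-sorted n = AllPairs.tabulate⁺-< <⇒≤

geq-filter⁺ : ∀ {n} {x : Fin n} {γ z} → z ∈ γ → toℕ x ≤ toℕ z → z ∈ₗ filter (geq? x γ) (allFin n)
geq-filter⁺ {x = x} {γ} {z} z∈γ x≤z = ∈-filter⁺ (geq? x γ) (∈-allFin z) (Equivalence.from Geq⇔ (z∈γ , x≤z))

smallestGeq-spec : ∀ {n} (x : Fin n) (γ : Column n) → SmallestGeq x γ (smallestGeq x γ)
smallestGeq-spec {n} x γ with filter (geq? x γ) (allFin n) in eq
... | [] = none λ z∈γ → ≰⇒> λ x≤z → case subst (_ ∈ₗ_) eq (geq-filter⁺ z∈γ x≤z) of λ ()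
... | y ∷ ys = least (proj₁ y-geq) (proj₂ y-geq) minimal
  where
  y-geq : y ∈ γ × toℕ x ≤ toℕ y
  y-geq = Equivalence.to Geq⇔ (proj₂ (∈-filter⁻ (geq? x γ) {xs = allFin n} (subst (y ∈ₗ_) (sym eq) (here refl))))
  minimal : ∀ {z} → z ∈ γ → toℕ x ≤ toℕ z → toℕ y ≤ toℕ z
  minimal z∈γ x≤z with subst (_ ∈ₗ_) eq (geq-filter⁺ z∈γ x≤z)
                     | subst (AllPairs _) eq (AllPairs.filter⁺ (geq? x γ) (allFin-sorted n))
  ... | here refl  | _        = ≤-refl
  ... | there z∈ys | y≤ys ∷ _ = All.lookup y≤ys z∈ys

x∈actL : ∀ {n} (x : Fin n) (γ : Column n) → x ∈ actL x γ
x∈actL x γ with smallestGeq x γ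
... | nothing = x∈p∪q⁺ (inj₂ (x∈⁅x⁆ x))
... | just _  = x∈p∪q⁺ (inj₂ (x∈⁅x⁆ x))

actL-keeps-< : ∀ {n} (x : Fin n) (γ : Column n) {z} → z ∈ γ → toℕ z < toℕ x → z ∈ actL x γ
actL-keeps-< x γ z∈γ z<x with smallestGeq x γ | smallestGeq-spec x γ
... | nothing | _              = x∈p∪q⁺ (inj₁ z∈γ)
... | just y  | least _ x≤y _ = x∈p∪q⁺ (inj₁ (x∈p∧x≢y⇒x∈p-y z∈γ λ { refl → <⇒≱ z<x x≤y }))

actL-fixes : ∀ {n} (x : Fin n) (γ : Column n) → x ∈ γ → actL x γ ≡ γ
actL-fixes x γ x∈γ with smallestGeq x γ | smallestGeq-spec x γ
... | nothing | none below = ⊥-elim (<-irrefl refl (below x∈γ))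
... | just y  | least _ x≤y minimal with toℕ-injective (≤-antisym (minimal x∈γ ≤-refl) x≤y)
...   | refl = x∈p⇒p-x∪⁅x⁆≡p x∈γ

none⇒disjoint : ∀ {n} {x : Fin n} {γ} → (∀ {z} → z ∈ γ → toℕ z < toℕ x) → ∀ {z} → z ∈ γ → z ∉ ⁅ x ⁆
none⇒disjoint below z∈γ z∈⁅x⁆ rewrite x∈⁅y⁆⇒x≡y _ z∈⁅x⁆ = <-irrefl refl (below z∈γ)

least⇒x∉γ-y : ∀ {n} {x y : Fin n} {γ} → toℕ x ≤ toℕ y →
              (∀ {z} → z ∈ γ → toℕ x ≤ toℕ z → toℕ y ≤ toℕ z) → x ∉ γ - y
least⇒x∉γ-y {y = y} {γ} x≤y minimal x∈γ-y
  with toℕ-injective (≤-antisym (minimal (p─q⊆p γ ⁅ y ⁆ x∈γ-y) ≤-refl) x≤y)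
... | refl = x∉p-x x∈γ-y

exchange-at : ∀ {n} {x y : Fin n} {γ : Column n} → y ∈ γ → toℕ x ≤ toℕ y →
              (∀ {z} → z ∈ γ → toℕ x ≤ toℕ z → toℕ y ≤ toℕ z) →
              ∀ t {a b} → count ⁅ y ⁆ t ≡ a → count ⁅ x ⁆ t ≡ b →
              count ((γ - y) ∪ ⁅ x ⁆) t + a ≡ count γ t + b
exchange-at y∈γ x≤y minimal t refl refl = count-exchange y∈γ (least⇒x∉γ-y x≤y minimal) t

suc≡⊔suc : ∀ {a b} → a ≡ b → suc a ≡ a ⊔ suc b
suc≡⊔suc refl = sym (m≤n⇒m⊔n≡n (n≤1+n _))

count-actL-≤ : ∀ {n} (x : Fin n) (γ : Column n) {t} → t ≤ toℕ x → count (actL x γ) t ≡ count γ t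
count-actL-≤ x γ {t} t≤x with smallestGeq x γ | smallestGeq-spec x γ
... | nothing | none below = begin
  count (γ ∪ ⁅ x ⁆) t         ≡⟨ count-∪ (none⇒disjoint below) t ⟩
  count γ t + count ⁅ x ⁆ t   ≡⟨ cong (count γ t +_) (count-⁅x⁆-≤ x t≤x) ⟩
  count γ t + 0               ≡⟨ +-identityʳ _ ⟩
  count γ t                   ∎
  where open ≡-Reasoning
... | just y  | least y∈γ x≤y minimal =
  +-cancelʳ-≡ 0 _ _ (exchange-at y∈γ x≤y minimal t (count-⁅x⁆-≤ y (≤-trans t≤x x≤y)) (count-⁅x⁆-≤ x t≤x))

count-actL-> : ∀ {n} (x : Fin n) (γ : Column n) {t} → toℕ x < t →
               count (actL x γ) t ≡ count γ t ⊔ suc (count γ (toℕ x))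
count-actL-> x γ {t} x<t with smallestGeq x γ | smallestGeq-spec x γ
... | nothing | none below = begin
  count (γ ∪ ⁅ x ⁆) t         ≡⟨ count-∪ (none⇒disjoint below) t ⟩
  count γ t + count ⁅ x ⁆ t   ≡⟨ cong (count γ t +_) (count-⁅x⁆-> x x<t) ⟩
  count γ t + 1               ≡⟨ +-comm _ 1 ⟩
  suc (count γ t)             ≡⟨ suc≡⊔suc (count-gap (λ z∈γ x≤z → ⊥-elim (<⇒≱ (below z∈γ) x≤z)) (<⇒≤ x<t)) ⟩
  count γ t ⊔ suc (count γ (toℕ x)) ∎
  where open ≡-Reasoning
... | just y  | least y∈γ x≤y minimal with ≤-<-connex t (toℕ y)
...   | inj₁ t≤y = begin
  count ((γ - y) ∪ ⁅ x ⁆) t      ≡⟨ +-identityʳ _ ⟨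
  count ((γ - y) ∪ ⁅ x ⁆) t + 0  ≡⟨ exchange-at y∈γ x≤y minimal t (count-⁅x⁆-≤ y t≤y) (count-⁅x⁆-> x x<t) ⟩
  count γ t + 1                  ≡⟨ +-comm _ 1 ⟩
  suc (count γ t)                ≡⟨ suc≡⊔suc (count-gap (λ z∈γ x≤z → ≤-trans t≤y (minimal z∈γ x≤z)) (<⇒≤ x<t)) ⟩
  count γ t ⊔ suc (count γ (toℕ x)) ∎
  where open ≡-Reasoning
...   | inj₂ y<t = trans
  (+-cancelʳ-≡ 1 _ _ (exchange-at y∈γ x≤y minimal t (count-⁅x⁆-> y y<t) (count-⁅x⁆-> x x<t)))
  (sym (m≥n⇒m⊔n≡m x-below-t))
  where
  open ≤-Reasoning
  x-below-t : suc (count γ (toℕ x)) ≤ count γ t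
  x-below-t = begin
    suc (count γ (toℕ x)) ≡⟨ cong suc (count-gap minimal x≤y) ⟨
    suc (count γ (toℕ y)) ≡⟨ count-suc-∈ y∈γ ⟨
    count γ (suc (toℕ y)) ≤⟨ count-mono γ y<t ⟩
    count γ t             ∎

actL-inflationary : ∀ {n} (x : Fin n) (γ : Column n) → γ ≼ actL x γ
actL-inflationary x γ t with ≤-<-connex t (toℕ x)
... | inj₁ t≤x = ≤-reflexive (sym (count-actL-≤ x γ t≤x))
... | inj₂ x<t = ≤-trans (m≤m⊔n _ _) (≤-reflexive (sym (count-actL-> x γ x<t)))

actL-monotone : ∀ {n} (x : Fin n) {γ δ : Column n} → γ ≼ δ → actL x γ ≼ actL x δ
actL-monotone x {γ} {δ} γ≼δ t with ≤-<-connex t (toℕ x)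
... | inj₁ t≤x = subst₂ _≤_ (sym (count-actL-≤ x γ t≤x)) (sym (count-actL-≤ x δ t≤x)) (γ≼δ t)
... | inj₂ x<t = subst₂ _≤_ (sym (count-actL-> x γ x<t)) (sym (count-actL-> x δ x<t))
                   (⊔-mono-≤ (γ≼δ t) (s≤s (γ≼δ (toℕ x))))

act-inflationary : ∀ {n} (w : Word n) (γ : Column n) → γ ≼ act w γ
act-inflationary []      γ t = ≤-refl
act-inflationary (x ∷ w) γ t = ≤-trans (act-inflationary w γ t) (actL-inflationary x (act w γ) t)

act-monotone : ∀ {n} (w : Word n) {γ δ : Column n} → γ ≼ δ → act w γ ≼ act w δ
act-monotone []      γ≼δ = γ≼δ
act-monotone (x ∷ w) γ≼δ = actL-monotone x (act-monotone w γ≼δ)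

act-++ : ∀ {n} (u v : Word n) (γ : Column n) → act (u ++ v) γ ≡ act u (act v γ)
act-++ []      v γ = refl
act-++ (x ∷ u) v γ = cong (actL x) (act-++ u v γ)

Supp-∷⁺ : ∀ {n} (x : Fin n) (w : Word n) {p} → x ∈ p → Supp w ⊆ p → Supp (x ∷ w) ⊆ p
Supp-∷⁺ x w x∈p w⊆p z∈ with x∈p∪q⁻ ⁅ x ⁆ (Supp w) z∈
... | inj₁ z∈⁅x⁆ rewrite x∈⁅y⁆⇒x≡y x z∈⁅x⁆ = x∈p
... | inj₂ z∈w = w⊆p z∈w

Supp-∷⁻ : ∀ {n} (x : Fin n) (w : Word n) {p} → Supp (x ∷ w) ⊆ p → x ∈ p × Supp w ⊆ p
Supp-∷⁻ x w xw⊆p = xw⊆p (x∈p∪q⁺ (inj₁ (x∈⁅x⁆ x))) , xw⊆p ∘ x∈p∪q⁺ ∘ inj₂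

Supp⊆⇒act-fixes : ∀ {n} (w : Word n) {γ : Column n} → Supp w ⊆ γ → act w γ ≡ γ
Supp⊆⇒act-fixes []      _    = refl
Supp⊆⇒act-fixes (x ∷ w) {γ} xw⊆γ =
  let (x∈γ , w⊆γ) = Supp-∷⁻ x w xw⊆γ
  in trans (cong (actL x) (Supp⊆⇒act-fixes w w⊆γ)) (actL-fixes x γ x∈γ)

act-fixes⇒Supp⊆ : ∀ {n} (w : Word n) {γ : Column n} → act w γ ≡ γ → Supp w ⊆ γ
act-fixes⇒Supp⊆ []      _     = ⊥-elim ∘ ∉⊥
act-fixes⇒Supp⊆ (x ∷ w) {γ} fixed = Supp-∷⁺ x w (subst (x ∈_) x-fixes (x∈actL x γ)) (act-fixes⇒Supp⊆ w w-fixes)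
  where
  w-fixes : act w γ ≡ γ
  w-fixes = ≼-antisym (subst (act w γ ≼_) fixed (actL-inflationary x (act w γ))) (act-inflationary w γ)
  x-fixes : actL x γ ≡ γ
  x-fixes = trans (cong (actL x) (sym w-fixes)) fixed

∈-Supp⁺ : ∀ {n} {w : Word n} {z} → z ∈ₗ w → z ∈ Supp w
∈-Supp⁺ {w = x ∷ w} (here refl)  = x∈p∪q⁺ (inj₁ (x∈⁅x⁆ x))
∈-Supp⁺ {w = x ∷ w} (there z∈w) = x∈p∪q⁺ (inj₂ (∈-Supp⁺ z∈w))

∈-Supp⁻ : ∀ {n} {w : Word n} {z} → z ∈ Supp w → z ∈ₗ w
∈-Supp⁻ {w = []}    = ⊥-elim ∘ ∉⊥
∈-Supp⁻ {w = x ∷ w} z∈ with x∈p∪q⁻ ⁅ x ⁆ (Supp w) z∈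
... | inj₁ z∈⁅x⁆ = here (x∈⁅y⁆⇒x≡y x z∈⁅x⁆)
... | inj₂ z∈w   = there (∈-Supp⁻ z∈w)

idempotent⇒Supp⊆act : ∀ {n} (w : Word n) → IsIdempotent w → ∀ γ → Supp w ⊆ act w γ
idempotent⇒Supp⊆act w idem γ = act-fixes⇒Supp⊆ w (trans (sym (act-++ w w γ)) (idem γ))

Supp⊆act⇒idempotent : ∀ {n} (w : Word n) → (∀ γ → Supp w ⊆ act w γ) → IsIdempotent w
Supp⊆act⇒idempotent w Supp⊆ γ = trans (act-++ w w γ) (Supp⊆⇒act-fixes w (Supp⊆ γ))

decreasing⇒Supp⊆act : ∀ {n} {d : Word n} → AllPairs _>_ d → ∀ γ → Supp d ⊆ act d γ
decreasing⇒Supp⊆act {d = []}    []               γ = ⊥-elim ∘ ∉⊥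
decreasing⇒Supp⊆act {d = x ∷ d} (x>d ∷ d-desc) γ =
  Supp-∷⁺ x d (x∈actL x (act d γ)) λ z∈d →
    actL-keeps-< x (act d γ) (decreasing⇒Supp⊆act d-desc γ z∈d) (All.lookup x>d (∈-Supp⁻ z∈d))

decreasing⇒idempotent : ∀ {n} {d : Word n} → StrictlyDecreasing d → IsIdempotent d
decreasing⇒idempotent {d = d} =
  Supp⊆act⇒idempotent d ∘ decreasing⇒Supp⊆act ∘ Linked⇒AllPairs (λ x>y y>z → <-trans y>z x>y)

≐-of-absorbing : ∀ {n} (u v : Word n) → (∀ γ → act v (act u γ) ≡ act u γ) →
                 (∀ γ → act u (act v γ) ≡ act v γ) → μ u ≐ μ v
≐-of-absorbing u v vu≡u uv≡v γ = ≼-antisym (below v u uv≡v) (below u v vu≡u)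
  where
  below : ∀ u v → (∀ γ → act v (act u γ) ≡ act u γ) → act v γ ≼ act u γ
  below u v vu≡u = subst (act v γ ≼_) (vu≡u γ) (act-monotone v (act-inflationary u γ))

idempotent-≐-of-Supp≡ : ∀ {n} (u v : Word n) → IsIdempotent u → IsIdempotent v →
                        Supp u ≡ Supp v → μ u ≐ μ v
idempotent-≐-of-Supp≡ u v u-idem v-idem u≡v = ≐-of-absorbing u v
  (λ γ → Supp⊆⇒act-fixes v (subst (_⊆ act u γ) u≡v (idempotent⇒Supp⊆act u u-idem γ)))
  (λ γ → Supp⊆⇒act-fixes u (subst (_⊆ act v γ) (sym u≡v) (idempotent⇒Supp⊆act v v-idem γ)))

Supp-cong : ∀ {n} (u v : Word n) → μ u ≐ μ v → Supp u ≡ Supp v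
Supp-cong u v u≐v = ⊆-antisym (u-fixes-Supp u v u≐v) (u-fixes-Supp v u (sym ∘ u≐v))
  where
  u-fixes-Supp : ∀ u v → μ u ≐ μ v → Supp u ⊆ Supp v
  u-fixes-Supp u v u≐v = act-fixes⇒Supp⊆ u (trans (u≐v (Supp v)) (Supp⊆⇒act-fixes v ⊆-refl))

idempotent-resp-≐ : ∀ {n} (u v : Word n) → μ u ≐ μ v → IsIdempotent v → IsIdempotent u
idempotent-resp-≐ u v u≐v v-idem γ = begin
  act (u ++ u) γ   ≡⟨ act-++ u u γ ⟩
  act u (act u γ)  ≡⟨ u≐v (act u γ) ⟩
  act v (act u γ)  ≡⟨ cong (act v) (u≐v γ) ⟩
  act v (act v γ)  ≡⟨ act-++ v v γ ⟨
  act (v ++ v) γ   ≡⟨ v-idem γ ⟩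
  act v γ          ≡⟨ u≐v γ ⟨
  act u γ          ∎
  where open ≡-Reasoning

columnWord : ∀ {n} → Column n → Word n
columnWord γ = filter (_∈? γ) (tabulate opposite)

opposite-descending : ∀ {n} → AllPairs _>_ (tabulate {n = n} opposite)
opposite-descending = AllPairs.tabulate⁺-< λ {i} {j} i<j →
  subst₂ _<_ (sym (opposite-prop j)) (sym (opposite-prop i)) (∸-monoʳ-< (s≤s i<j) (toℕ<n j))

columnWord-decreasing : ∀ {n} (γ : Column n) → StrictlyDecreasing (columnWord γ)
columnWord-decreasing γ = AllPairs⇒Linked (AllPairs.filter⁺ (_∈? γ) opposite-descending)

Supp-columnWord : ∀ {n} (γ : Column n) → Supp (columnWord γ) ≡ γ
Supp-columnWord γ = ⊆-antisym
  (λ z∈ → proj₂ (∈-filter⁻ (_∈? γ) {xs = tabulate opposite} (∈-Supp⁻ z∈)))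
  (λ {z} z∈γ → ∈-Supp⁺ (∈-filter⁺ (_∈? γ) (∈-opposites z) z∈γ))
  where
  ∈-opposites : ∀ z → z ∈ₗ tabulate opposite
  ∈-opposites z = subst (_∈ₗ tabulate opposite) (opposite-involutive z) (∈-tabulate⁺ (opposite z))

idempotent≐columnWord : ∀ {n} (w : Word n) → IsIdempotent w → μ w ≐ μ (columnWord (Supp w))
idempotent≐columnWord w w-idem = idempotent-≐-of-Supp≡ w (columnWord (Supp w)) w-idem
  (decreasing⇒idempotent (columnWord-decreasing (Supp w))) (sym (Supp-columnWord (Supp w)))

columnWord-μ-injective : ∀ {n} (γ δ : Column n) → μ (columnWord γ) ≐ μ (columnWord δ) → γ ≡ δ
columnWord-μ-injective γ δ γ≐δ = begin
  γ                       ≡⟨ Supp-columnWord γ ⟨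
  Supp (columnWord γ)     ≡⟨ Supp-cong (columnWord γ) (columnWord δ) γ≐δ ⟩
  Supp (columnWord δ)     ≡⟨ Supp-columnWord δ ⟩
  δ                       ∎
  where open ≡-Reasoning

Fin[2^n]↔Column : ∀ n → Fin (2 ^ n) ↔ Column n
Fin[2^n]↔Column n = ↔-trans (Fin[m^n]↔Fin[m]^n 2 n) (↔-trans (lift↔ n 2↔Bool) (↔Vec n))

theorem12p1 : (n : ℕ) →
    (∀ (w : Word n) (γ : Column n) → (act w γ ≡ γ) ⇔ (Supp w ⊆ γ))
    × (∀ (w : Word n) → (act w (Supp w) ≡ Supp w)
         × (∀ (γ : Column n) → act w γ ≡ γ → Supp w ⊆ γ))
    × (∀ (w : Word n) → IsIdempotent w
         ⇔ Σ (Word n) (λ d → StrictlyDecreasing d × (μ w ≐ μ d)))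
    × Σ (Fin (2 ^ n) → Word n) (λ e →
         (∀ i → IsIdempotent (e i))
         × (∀ i j → μ (e i) ≐ μ (e j) → i ≡ j)
         × (∀ w → IsIdempotent w → Σ (Fin (2 ^ n)) (λ i → μ w ≐ μ (e i))))
theorem12p1 n =
    (λ w γ → mk⇔ (act-fixes⇒Supp⊆ w) (Supp⊆⇒act-fixes w))
  , (λ w → Supp⊆⇒act-fixes w ⊆-refl , λ γ → act-fixes⇒Supp⊆ w)
  , (λ w → mk⇔ (λ w-idem → columnWord (Supp w) , columnWord-decreasing (Supp w) , idempotent≐columnWord w w-idem)
               (λ (d , d-desc , w≐d) → idempotent-resp-≐ w d w≐d (decreasing⇒idempotent d-desc)))
  , columnWord ∘ to
  , (λ i → decreasing⇒idempotent (columnWord-decreasing (to i)))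
  , (λ i j → to-injective ∘ columnWord-μ-injective (to i) (to j))
  , (λ w w-idem → from (Supp w) ,
       subst (λ γ → μ w ≐ μ (columnWord γ)) (sym (strictlyInverseˡ (Supp w))) (idempotent≐columnWord w w-idem))
  where
  open Inverse (Fin[2^n]↔Column n) using (to; from; strictlyInverseˡ)
  to-injective : ∀ {i j} → to i ≡ to j → i ≡ j
  to-injective = Injection.injective (↔⇒↣ (Fin[2^n]↔Column n))
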